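{- An ascent sequence avoids the pattern $101$ if and only if it avoids the pattern $0101$. For every $n\ge1$, the number of ascent sequences of length $n$ avoiding $101$ equals the Catalan number $C_n=\frac{1}{n+1}\binom{2n}{n}$. Moreover, the number of ascents on these sequences has the Narayana distribution: for $0\le k\le n-1$, the number of $101$-avoiding ascent sequences of length $n$ with exactly $k$ ascents is $N(n,k+1)=\frac1n\binom{n}{k+1}\binom{n}{k}$.
   Context: An ascent sequence is a finite sequence $x_1x_2\ldots x_n$ of nonnegative integers with $x_1=0$ and $x_i\le \operatorname{asc}(x_1\ldots x_{i-1})+1$ for all $1<i\le n$, where $\operatorname{asc}(y_1\ldots y_k)$ is the number of indices $j$ with $y_j<y_{j+1}$ (ascents). A pattern is a finite word over the nonnegative integers. An occurrence of a pattern $p=p_1\ldots p_k$ in a sequence $x_1\ldots x_n$ is a subsequence $x_{i_1}\ldots x_{i_k}$, $i_1<\cdots<i_k$, such that for all $a,b$: $x_{i_a}<x_{i_b}$ iff $p_a<p_b$ and $x_{i_a}=x_{i_b}$ iff $p_a=p_b$. A sequence avoids $p$ if it has no occurrence of $p$. The Narayana numbers are $N(n,k)=\frac1n\binom{n}{k}\binom{n}{k-1}$. -}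

module Defs where

open import Data.Nat using (_∸_; ℕ; zero; suc; _+_; _*_; _≤_; _<_; _<ᵇ_; NonZero)
open import Data.Nat.Combinatorics using (_C_)
open import Data.Nat.DivMod using (_/_)
open import Data.Bool using (if_then_else_)
open import Data.Fin using (Fin; toℕ; cast)
open import Data.List using (List; []; _∷_; length; lookup; take)
open import Data.List.Relation.Binary.Sublist.Propositional using (_⊆_)
open import Data.List.Relation.Unary.Unique.Propositional using (Unique)
open import Data.List.Membership.Propositional using (_∈_)
open import Data.Product using (Σ; ∃-syntax; _×_)
open import Function.Bundles using (_⇔_)
open import Relation.Binary.PropositionalEquality using (_≡_)
open import Relation.Nullary using (¬_)

asc : List ℕ → ℕ
asc [] = 0
asc (x ∷ []) = 0
asc (x ∷ y ∷ r) = (if x <ᵇ y then 1 else 0) + asc (y ∷ r)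

-- ascent sequence: x_1 = 0 and x_i ≤ asc(x_1 … x_{i-1}) + 1 for 1 < i ≤ n
-- (0-indexed position i ≥ 1; its prefix is take i xs)
IsAscentSeq : List ℕ → Set
IsAscentSeq xs =
  (∃[ ys ] xs ≡ 0 ∷ ys) ×
  (∀ (i : Fin (length xs)) → 0 < toℕ i → lookup xs i ≤ suc (asc (take (toℕ i) xs)))

OrderIso : List ℕ → List ℕ → Set
OrderIso w p =
  Σ (length w ≡ length p) λ eq →
    ∀ (a b : Fin (length w)) →
      ((lookup w a < lookup w b) ⇔ (lookup p (cast eq a) < lookup p (cast eq b))) ×
      ((lookup w a ≡ lookup w b) ⇔ (lookup p (cast eq a) ≡ lookup p (cast eq b)))

Occurs : List ℕ → List ℕ → Set
Occurs p xs = ∃[ w ] (w ⊆ xs) × OrderIso w p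

Avoids : List ℕ → List ℕ → Set
Avoids p xs = ¬ Occurs p xs

HasCount : (List ℕ → Set) → ℕ → Set
HasCount P c = ∃[ L ] Unique L × (∀ xs → (xs ∈ L) ⇔ P xs) × (length L ≡ c)

catalan : ℕ → ℕ
catalan n = ((2 * n) C n) / suc n

-- N(n,k) for n ≥ 1, written with n = suc m
narayana : ℕ → ℕ → ℕ
narayana m k = ((suc m C k) * (suc m C (k ∸ 1))) / suc m

module Submission where

-- Read a 101-avoiding ascent sequence 0 x₂ … xₙ from left to right, keeping
-- a stack of the "open" values, those not yet followed by a smaller letter.
-- Each next letter is either the new maximum (pushed) or an open value x
-- (the entries above x are popped, as x now follows them); conversely every
-- such sequence of moves spells a 101-avoiding ascent sequence, whose ascents
-- are exactly its new maxima.  These stack runs are listed without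
-- repetition by a recursive generator; its size satisfies recursions whose
-- closed forms are ballot numbers, giving Catalan and Narayana numbers.

open import Defs
open import Data.Bool using (true; false; if_then_else_)
open import Data.Empty using (⊥; ⊥-elim)
open import Data.Unit using (⊤; tt)
open import Data.Fin using (Fin; zero; suc; toℕ; cast)
open import Data.Nat
open import Data.Nat.Properties
open import Data.Nat.Combinatorics using (_C_; nCk+nC[k+1]≡[n+1]C[k+1]; nC1≡n; nCn≡1; k>n⇒nCk≡0; nCk≡nC[n∸k])
open import Data.Nat.DivMod using (m*n/n≡m)
open import Data.Nat.Tactic.RingSolver using (solve-∀)
open import Data.List using (List; []; _∷_; _++_; [_]; length; lookup; take; map; filter)
open import Data.List.Properties
  using (length-++; length-map; filter-++; filter-≐; filter-none; ∷-injectiveʳ; ∷ʳ-injective; ++-assoc; ++-identityʳ)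
open import Data.List.Membership.Propositional using (_∈_)
open import Data.List.Membership.Propositional.Properties
  using (∈-++⁺ˡ; ∈-++⁺ʳ; ∈-++⁻; ∈-map⁺; ∈-map⁻; ∈-filter⁺; ∈-filter⁻)
open import Data.List.Membership.DecPropositional _≟_ using (_∈?_)
open import Data.List.Relation.Unary.Any using (here; there)
open import Data.List.Relation.Unary.All as All using (All; []; _∷_)
open import Data.List.Relation.Unary.AllPairs using (AllPairs; []; _∷_)
open import Data.List.Relation.Unary.Unique.Propositional using (Unique)
import Data.List.Relation.Unary.Unique.Propositional.Properties as Unique
open import Data.List.Relation.Binary.Sublist.Propositional as Sublist
  using (_⊆_; []; _∷_; _∷ʳ_; ⊆-refl; ⊆-trans; minimum; from∈; to∈)
import Data.List.Relation.Binary.Sublist.Propositional.Properties as Sublistₚ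
open import Data.Product using (∃-syntax; _×_; _,_; proj₁; proj₂)
open import Data.Sum using (_⊎_; inj₁; inj₂)
open import Function using (_∘_)
open import Function.Bundles using (_⇔_; mk⇔; Equivalence)
open import Level using (0ℓ)
open import Relation.Nullary using (¬_; does; yes; no)
open import Relation.Unary using (Pred; Decidable)
open import Relation.Binary.Definitions using (tri<; tri≈; tri>)
open import Relation.Binary.PropositionalEquality
  using (_≡_; refl; sym; trans; cong; cong₂; subst; subst₂; module ≡-Reasoning)
open ≡-Reasoning

pascal : ∀ n k → n C k + n C suc k ≡ suc n C suc k
pascal = nCk+nC[k+1]≡[n+1]C[k+1]

-- The shifted binomial coefficient n C⁻ k = C(n, k-1), with C(n, -1) = 0;
-- it keeps all closed forms below free of subtraction.
infixl 6.5 _C⁻_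
_C⁻_ : ℕ → ℕ → ℕ
n C⁻ zero = 0
n C⁻ suc k = n C k

pascal⁻ : ∀ n k → n C⁻ k + n C k ≡ suc n C k
pascal⁻ n zero = refl
pascal⁻ n (suc k) = pascal n k

absorption : ∀ n k → suc k * (suc n C suc k) ≡ suc n * (n C k)
absorption zero zero = refl
absorption zero (suc k) = *-zeroʳ (suc (suc k))
absorption (suc n) zero = trans (*-identityˡ _) (trans (nC1≡n (suc (suc n))) (sym (*-identityʳ _)))
absorption (suc n) (suc k) = begin
  (2 + k) * (suc (suc n) C (2 + k))                     ≡⟨ cong ((2 + k) *_) (sym (pascal (suc n) (suc k))) ⟩
  (2 + k) * (x + y)                                    ≡⟨ split k x y ⟩
  x + (suc k * x) + (2 + k) * y                        ≡⟨ cong₂ (λ u v → x + u + v) (absorption n k) (absorption n (suc k)) ⟩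
  x + suc n * (n C k) + suc n * (n C suc k)            ≡⟨ join n (n C k) (n C suc k) x ⟩
  x + suc n * (n C k + n C suc k)                      ≡⟨ cong (λ u → x + suc n * u) (pascal n k) ⟩
  x + suc n * x                                        ≡⟨ collect n x ⟩
  (2 + n) * x                                          ∎
  where
  x : ℕ
  x = suc n C suc k
  y : ℕ
  y = suc n C (2 + k)
  split : ∀ k x y → (2 + k) * (x + y) ≡ x + ((1 + k) * x) + (2 + k) * y
  split = solve-∀
  join : ∀ n a b z → z + (1 + n) * a + (1 + n) * b ≡ z + (1 + n) * (a + b)
  join = solve-∀
  collect : ∀ n z → z + (1 + n) * z ≡ (2 + n) * z
  collect = solve-∀

binomial-ratio : ∀ n k → suc k * (n C suc k) + k * (n C k) ≡ n * (n C k)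
binomial-ratio n k = +-cancelˡ-≡ (n C k) _ _ (begin
  n C k + (suc k * (n C suc k) + k * (n C k)) ≡⟨ regroup k (n C k) (n C suc k) ⟩
  suc k * (n C k + n C suc k)                 ≡⟨ cong (suc k *_) (pascal n k) ⟩
  suc k * (suc n C suc k)                     ≡⟨ absorption n k ⟩
  suc n * (n C k)                             ∎)
  where
  regroup : ∀ k a b → a + ((1 + k) * b + k * a) ≡ (1 + k) * (a + b)
  regroup = solve-∀

binomial-ratio⁻ : ∀ m k → k * (m C k) + k * (m C⁻ k) ≡ suc m * (m C⁻ k)
binomial-ratio⁻ m zero = sym (*-zeroʳ (suc m))
binomial-ratio⁻ m (suc j) = begin
  suc j * (m C suc j) + suc j * (m C j)         ≡⟨ regroup j (m C suc j) (m C j) ⟩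
  suc j * (m C suc j) + j * (m C j) + m C j     ≡⟨ cong (_+ m C j) (binomial-ratio m j) ⟩
  m * (m C j) + m C j                           ≡⟨ +-comm (m * (m C j)) (m C j) ⟩
  suc m * (m C j)                               ∎
  where
  regroup : ∀ j a b → (1 + j) * a + (1 + j) * b ≡ ((1 + j) * a + j * b) + b
  regroup = solve-∀

middle-symmetry : ∀ n → (n + n + 1) C suc n ≡ (n + n + 1) C n
middle-symmetry n = sym (trans (nCk≡nC[n∸k] n≤N) (cong (N C_) N∸n≡1+n))
  where
  N : ℕ
  N = n + n + 1
  n≤N : n ≤ N
  n≤N = ≤-trans (m≤m+n n n) (m≤m+n (n + n) 1)
  N∸n≡1+n : N ∸ n ≡ suc n
  N∸n≡1+n = trans (cong (_∸ n) (+-assoc n n 1)) (trans (m+n∸m≡n n (n + 1)) (+-comm n 1))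

-- nRunsAsc s n k counts the stack runs (defined below) of length n with k
-- ascents starting from a stack of height s; nOldRunsAsc s n k counts those
-- whose first letter revisits the stack, one summand per stack entry.
mutual
  nRunsAsc : ℕ → ℕ → ℕ → ℕ
  nRunsAsc s zero zero = 1
  nRunsAsc s zero (suc k) = 0
  nRunsAsc s (suc n) zero = nOldRunsAsc s n zero
  nRunsAsc s (suc n) (suc k) = nRunsAsc (suc s) n k + nOldRunsAsc s n (suc k)

  nOldRunsAsc : ℕ → ℕ → ℕ → ℕ
  nOldRunsAsc zero n k = 0
  nOldRunsAsc (suc s) n k = nRunsAsc (suc s) n k + nOldRunsAsc s n k

-- Two ways of recombining instances of the closed forms below; only the
-- additive structure matters, so they are stated for arbitrary numbers.
combine-new : ∀ F G b c d M K → F + b * (M C suc K) ≡ c * (M C K) → G + c * (M C suc K) ≡ d * (M C K)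
            → (F + G) + (b + c) * (M C suc K) ≡ (c + d) * (M C K)
combine-new F G b c d M K e₁ e₂ = begin
  (F + G) + (b + c) * X           ≡⟨ regroup F G b c X ⟩
  (F + b * X) + (G + c * X)       ≡⟨ cong₂ _+_ e₁ e₂ ⟩
  c * (M C K) + d * (M C K)       ≡⟨ *-distribʳ-+ (M C K) c d ⟨
  (c + d) * (M C K)               ∎
  where
  X : ℕ
  X = M C suc K
  regroup : ∀ F G b c X → (F + G) + (b + c) * X ≡ (F + b * X) + (G + c * X)
  regroup = solve-∀

combine-old : ∀ F G b c M K → F + b * (M C suc (suc K)) ≡ c * (M C suc K) → G + b * (M C suc K) ≡ c * (M C K)
            → (F + G) + b * (suc M C suc (suc K)) ≡ c * (suc M C suc K)
combine-old F G b c M K e₁ e₂ = begin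
  (F + G) + b * (suc M C suc (suc K))      ≡⟨ cong (λ u → (F + G) + b * u) (sym (pascal M (suc K))) ⟩
  (F + G) + b * (Y + X)                    ≡⟨ regroup F G b X Y ⟩
  (F + b * X) + (G + b * Y)                ≡⟨ cong₂ _+_ e₁ e₂ ⟩
  c * Y + c * (M C K)                      ≡⟨ +-comm (c * Y) (c * (M C K)) ⟩
  c * (M C K) + c * Y                      ≡⟨ *-distribˡ-+ c (M C K) Y ⟨
  c * (M C K + Y)                          ≡⟨ cong (c *_) (pascal M K) ⟩
  c * (suc M C suc K)                      ∎
  where
  X : ℕ
  X = M C suc (suc K)
  Y : ℕ
  Y = M C suc K
  regroup : ∀ F G b X Y → (F + G) + b * (Y + X) ≡ (F + b * X) + (G + b * Y)
  regroup = solve-∀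

-- Closed forms, for a stack of height s+1:
--   nRunsAsc (s+1) n k    = C(n,k) C(n+s,k+s)   - C(n,k-1) C(n+s,k+s+1),
--   nOldRunsAsc (s+1) n k = C(n,k) C(n+s+1,k+s) - C(n,k-1) C(n+s+1,k+s+1),
-- proved simultaneously by induction on n and s, in subtraction-free form.
mutual
  nRunsAsc-closed : ∀ s n k →
    nRunsAsc (suc s) n k + (n C⁻ k) * ((n + s) C suc (k + s)) ≡ (n C k) * ((n + s) C (k + s))
  nRunsAsc-closed s zero zero = sym (trans (*-identityˡ (s C s)) (nCn≡1 s))
  nRunsAsc-closed s zero (suc k) =
    trans (cong ((0 C k) *_) (k>n⇒nCk≡0 (s≤s (m≤n+m s (suc k))))) (*-zeroʳ (0 C k))
  nRunsAsc-closed s (suc n) zero = nOldRunsAsc-closed s n zero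
  nRunsAsc-closed s (suc n) (suc k) = begin
    nRunsAsc (2 + s) n k + nOldRunsAsc (suc s) n (suc k) + (suc n C k) * (suc (n + s) C (2 + k + s))
      ≡⟨ cong (λ u → nRunsAsc (2 + s) n k + nOldRunsAsc (suc s) n (suc k) + u * (suc (n + s) C (2 + k + s)))
              (sym (pascal⁻ n k)) ⟩
    nRunsAsc (2 + s) n k + nOldRunsAsc (suc s) n (suc k) + (n C⁻ k + n C k) * (suc (n + s) C (2 + k + s))
      ≡⟨ combine-new _ _ (n C⁻ k) (n C k) (n C suc k) (suc (n + s)) (suc (k + s))
                     (nRunsAsc-closed′ s n k) (nOldRunsAsc-closed s n (suc k)) ⟩
    (n C k + n C suc k) * (suc (n + s) C suc (k + s))
      ≡⟨ cong (_* (suc (n + s) C suc (k + s))) (pascal n k) ⟩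
    (suc n C suc k) * (suc (n + s) C suc (k + s)) ∎

  nOldRunsAsc-closed : ∀ s n k →
    nOldRunsAsc (suc s) n k + (n C⁻ k) * (suc (n + s) C suc (k + s)) ≡ (n C k) * (suc (n + s) C (k + s))
  nOldRunsAsc-closed zero n k =
    subst₂ (λ n′ k′ → nRunsAsc 1 n k + 0 + (n C⁻ k) * (suc n′ C suc k′) ≡ (n C k) * (suc n′ C k′))
           (sym (+-identityʳ n)) (sym (+-identityʳ k)) bottom
    where
    a : ℕ
    a = n C k
    b : ℕ
    b = n C⁻ k
    c : ℕ
    c = n C suc k
    base : nRunsAsc 1 n k + b * c ≡ a * a
    base = subst₂ (λ n′ k′ → nRunsAsc 1 n k + b * (n′ C suc k′) ≡ a * (n′ C k′))
                  (+-identityʳ n) (+-identityʳ k) (nRunsAsc-closed zero n k)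
    regroup : ∀ F b c d → F + 0 + b * (c + d) ≡ (F + b * d) + b * c
    regroup = solve-∀
    bottom : nRunsAsc 1 n k + 0 + b * (suc n C suc k) ≡ a * (suc n C k)
    bottom = begin
      nRunsAsc 1 n k + 0 + b * (suc n C suc k) ≡⟨ cong (λ u → nRunsAsc 1 n k + 0 + b * u) (sym (pascal n k)) ⟩
      nRunsAsc 1 n k + 0 + b * (a + c)         ≡⟨ regroup (nRunsAsc 1 n k) b a c ⟩
      (nRunsAsc 1 n k + b * c) + b * a         ≡⟨ cong (_+ b * a) base ⟩
      a * a + b * a                            ≡⟨ *-distribʳ-+ a a b ⟨
      (a + b) * a                              ≡⟨ *-comm (a + b) a ⟩
      a * (a + b)                              ≡⟨ cong (a *_) (trans (+-comm a b) (pascal⁻ n k)) ⟩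
      a * (suc n C k)                          ∎
  nOldRunsAsc-closed (suc s) n k =
    subst₂ (λ n′ k′ → nRunsAsc (2 + s) n k + nOldRunsAsc (suc s) n k + (n C⁻ k) * (suc n′ C suc k′)
                        ≡ (n C k) * (suc n′ C k′))
           (sym (+-suc n s)) (sym (+-suc k s))
           (combine-old (nRunsAsc (2 + s) n k) (nOldRunsAsc (suc s) n k) (n C⁻ k) (n C k) (suc (n + s)) (k + s)
                        (nRunsAsc-closed′ s n k) (nOldRunsAsc-closed s n k))

  nRunsAsc-closed′ : ∀ s n k →
    nRunsAsc (2 + s) n k + (n C⁻ k) * (suc (n + s) C suc (suc (k + s))) ≡ (n C k) * (suc (n + s) C suc (k + s))
  nRunsAsc-closed′ s n k =
    subst₂ (λ n′ k′ → nRunsAsc (2 + s) n k + (n C⁻ k) * (n′ C suc k′) ≡ (n C k) * (n′ C k′))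
           (+-suc n s) (+-suc k s) (nRunsAsc-closed (suc s) n k)

-- Narayana: with a = C(m,k), b = C(m,k-1), c = C(m,k+1), the closed form reads
-- F + bc = a², and the two binomial ratios turn (m+1)(a² - bc) into
-- (a+c)(a+b) = C(m+1,k+1) C(m+1,k).  The final step is a polynomial identity
-- (a linear combination of the three relations), checked by the ring solver.
narayana-product : ∀ m k → (suc m C suc k) * (suc m C k) ≡ nRunsAsc 1 m k * suc m
narayana-product m k = begin
  (suc m C suc k) * (suc m C k) ≡⟨ cong₂ _*_ (sym (pascal m k)) (sym (pascal⁻ m k)) ⟩
  (a + c) * (b + a)             ≡⟨ +-cancelʳ-≡ _ _ _ combination ⟩
  suc m * F                     ≡⟨ *-comm (suc m) F ⟩
  F * suc m                     ∎
  where
  a : ℕ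
  a = m C k
  b : ℕ
  b = m C⁻ k
  c : ℕ
  c = m C suc k
  F : ℕ
  F = nRunsAsc 1 m k
  base : F + b * c ≡ a * a
  base = subst₂ (λ m′ k′ → F + b * (m′ C suc k′) ≡ a * (m′ C k′))
                (+-identityʳ m) (+-identityʳ k) (nRunsAsc-closed zero m k)
  E : ℕ
  E = (a + b) * (m * a) + (a + c) * (suc m * b) + suc m * (a * a)
  certificate : ∀ m k a b c F →
    (a + c) * (b + a) + ((a + b) * (m * a) + (a + c) * (k * a + k * b) + (1 + m) * (F + b * c))
    ≡ (1 + m) * F + ((a + b) * ((1 + k) * c + k * a) + (a + c) * ((1 + m) * b) + (1 + m) * (a * a))
  certificate = solve-∀
  combination : (a + c) * (b + a) + E ≡ suc m * F + E
  combination = begin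
    (a + c) * (b + a) + E
      ≡⟨ cong₂ (λ u v → (a + c) * (b + a) + ((a + b) * (m * a) + (a + c) * u + suc m * v))
               (sym (binomial-ratio⁻ m k)) (sym base) ⟩
    (a + c) * (b + a) + ((a + b) * (m * a) + (a + c) * (k * a + k * b) + suc m * (F + b * c))
      ≡⟨ certificate m k a b c F ⟩
    suc m * F + ((a + b) * (suc k * c + k * a) + (a + c) * (suc m * b) + suc m * (a * a))
      ≡⟨ cong (λ u → suc m * F + ((a + b) * u + (a + c) * (suc m * b) + suc m * (a * a)))
              (binomial-ratio m k) ⟩
    suc m * F + E ∎

narayana-nRunsAsc : ∀ m k → nRunsAsc 1 m k ≡ narayana m (suc k)
narayana-nRunsAsc m k =
  sym (trans (cong (_/ suc m) (narayana-product m k)) (m*n/n≡m (nRunsAsc 1 m k) (suc m)))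

-- nRuns s n counts all stack runs of length n from a stack of height s, and
-- nOldRuns s n those whose first letter revisits the stack.
mutual
  nRuns : ℕ → ℕ → ℕ
  nRuns s zero = 1
  nRuns s (suc n) = nRuns (suc s) n + nOldRuns s n

  nOldRuns : ℕ → ℕ → ℕ
  nOldRuns zero n = 0
  nOldRuns (suc s) n = nRuns (suc s) n + nOldRuns s n

combine : ∀ h g b x y → h + b ≡ x → g + x ≡ y → (h + g) + (b + x) ≡ x + y
combine h g b x y e₁ e₂ = trans (regroup h g b x) (cong₂ _+_ e₁ e₂)
  where
  regroup : ∀ h g b x → (h + g) + (b + x) ≡ (h + b) + (g + x)
  regroup = solve-∀

-- Ballot-number closed forms, with N = 2n+s+1:
--   nRuns (s+1) n = C(N,n) - C(N,n-1),   nOldRuns (s+1) n = C(N+1,n+1) - C(N+1,n).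
mutual
  nRuns-closed : ∀ s n → nRuns (suc s) n + (n + n + suc s) C⁻ n ≡ (n + n + suc s) C n
  nRuns-closed s zero = refl
  nRuns-closed s (suc n) =
    subst (λ N → nRuns (2 + s) n + nOldRuns (suc s) n + (suc N C n) ≡ suc N C suc n)
          (sym (trans (cong (_+ suc s) (+-suc n n)) (sym (+-suc (n + n) (suc s)))))
          (nRuns-step s n)

  nOldRuns-closed : ∀ s n → nOldRuns (suc s) n + (n + n + suc (suc s)) C n ≡ (n + n + suc (suc s)) C suc n
  nOldRuns-closed zero n =
    subst (λ N → nRuns 1 n + 0 + (N C n) ≡ N C suc n) (sym (+-suc (n + n) 1)) (begin
      nRuns 1 n + 0 + (suc N C n)      ≡⟨ cong (nRuns 1 n + 0 +_) (sym (pascal⁻ N n)) ⟩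
      nRuns 1 n + 0 + (N C⁻ n + N C n) ≡⟨ combine (nRuns 1 n) 0 (N C⁻ n) (N C n) (N C n) (nRuns-closed zero n) refl ⟩
      N C n + N C n                    ≡⟨ cong (N C n +_) (sym (middle-symmetry n)) ⟩
      N C n + N C suc n                ≡⟨ pascal N n ⟩
      suc N C suc n                    ∎)
    where
    N : ℕ
    N = n + n + 1
  nOldRuns-closed (suc s) n =
    subst (λ N → nRuns (2 + s) n + nOldRuns (suc s) n + (N C n) ≡ N C suc n)
          (sym (+-suc (n + n) (2 + s))) (nRuns-step s n)

  nRuns-step : ∀ s n → let M = n + n + suc (suc s) in
               nRuns (2 + s) n + nOldRuns (suc s) n + (suc M C n) ≡ suc M C suc n
  nRuns-step s n = begin
    nRuns (2 + s) n + nOldRuns (suc s) n + (suc M C n)      ≡⟨ cong (nRuns (2 + s) n + nOldRuns (suc s) n +_) (sym (pascal⁻ M n)) ⟩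
    nRuns (2 + s) n + nOldRuns (suc s) n + (M C⁻ n + M C n) ≡⟨ combine _ _ (M C⁻ n) (M C n) (M C suc n) (nRuns-closed (suc s) n) (nOldRuns-closed s n) ⟩
    M C n + M C suc n                                       ≡⟨ pascal M n ⟩
    suc M C suc n                                           ∎
    where
    M : ℕ
    M = n + n + suc (suc s)

-- Catalan: with N = 2m+2, X = C(N,m+1), Y = C(N,m), the closed form gives
-- nRuns 1 m + Y = X and the binomial ratio gives (m+1) X + m Y = N Y; together
-- (m+2) nRuns 1 m = X, which is again a linear combination of the two.
catalan-product : ∀ m → (2 * suc m) C suc m ≡ nRuns 1 m * (2 + m)
catalan-product m = subst (λ N′ → N′ C suc m ≡ nRuns 1 m * (2 + m)) (sym (twice m)) X≡H*[2+m]
  where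
  twice : ∀ m → 2 * (1 + m) ≡ m + m + 2
  twice = solve-∀
  N : ℕ
  N = m + m + 2
  X : ℕ
  X = N C suc m
  Y : ℕ
  Y = N C m
  H : ℕ
  H = nRuns 1 m
  certificate : ∀ h x y m →
    x + (((1 + m) * x + m * y) + (2 + m) * (h + 0 + y)) ≡ h * (2 + m) + ((m + m + 2) * y + (2 + m) * x)
  certificate = solve-∀
  X≡H*[2+m] : X ≡ H * (2 + m)
  X≡H*[2+m] = +-cancelʳ-≡ _ _ _ (begin
    X + (N * Y + (2 + m) * X)
      ≡⟨ cong₂ (λ u v → X + (u + (2 + m) * v)) (sym (binomial-ratio N m)) (sym (nOldRuns-closed zero m)) ⟩
    X + ((suc m * X + m * Y) + (2 + m) * (H + 0 + Y))
      ≡⟨ certificate H X Y m ⟩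
    H * (2 + m) + (N * Y + (2 + m) * X) ∎)

catalan-nRuns : ∀ m → nRuns 1 m ≡ catalan (suc m)
catalan-nRuns m = sym (trans (cong (_/ (2 + m)) (catalan-product m)) (m*n/n≡m (nRuns 1 m) (2 + m)))

-- Pop x suf st: the stack st (top first) contains x, and popping every entry
-- above x leaves the stack x ∷ suf.
data Pop (x : ℕ) (suf : List ℕ) : List ℕ → Set where
  here  : Pop x suf (x ∷ suf)
  there : ∀ {y ys} → Pop x suf ys → Pop x suf (y ∷ ys)

Pop⇒∈ : ∀ {x suf st} → Pop x suf st → x ∈ st
Pop⇒∈ here = here refl
Pop⇒∈ (there p) = there (Pop⇒∈ p)

Pop-decreasing : ∀ {x suf st} → AllPairs _>_ st → Pop x suf st → AllPairs _>_ (x ∷ suf)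
Pop-decreasing dec here = dec
Pop-decreasing (_ ∷ dec) (there pop) = Pop-decreasing dec pop

Pop-⊆ : ∀ {x suf st v} → Pop x suf st → v ∈ x ∷ suf → v ∈ st
Pop-⊆ here v∈ = v∈
Pop-⊆ (there pop) v∈ = there (Pop-⊆ pop v∈)

Pop-keeps : ∀ {x suf st v} → AllPairs _>_ st → Pop x suf st → v ∈ st → v ≤ x → v ∈ x ∷ suf
Pop-keeps dec here v∈ v≤x = v∈
Pop-keeps (y>ys ∷ dec) (there pop) (here refl) v≤x = ⊥-elim (<⇒≱ (All.lookup y>ys (Pop⇒∈ pop)) v≤x)
Pop-keeps (_ ∷ dec) (there pop) (there v∈) v≤x = Pop-keeps dec pop v∈ v≤x

∈⇒Pop : ∀ {v st} → v ∈ st → ∃[ suf ] Pop v suf st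
∈⇒Pop {st = y ∷ ys} (here refl) = ys , here
∈⇒Pop (there v∈) with ∈⇒Pop v∈
... | suf , pop = suf , there pop

top-max : ∀ {l st v} → AllPairs _>_ (l ∷ st) → v ∈ l ∷ st → v ≤ l
top-max dec (here refl) = ≤-refl
top-max (l>st ∷ _) (there v∈) = <⇒≤ (All.lookup l>st v∈)

-- Run st mx r: the word r is produced from the stack st with current maximum
-- mx by steps that either write the new maximum mx+1 and push it, or write a
-- stack entry x after popping everything above x.  These runs are exactly
-- the 101-avoiding ascent sequences (after the initial 0).
data Run : List ℕ → ℕ → List ℕ → Set where
  done : ∀ {st mx} → Run st mx []
  new  : ∀ {st mx r} → Run (suc mx ∷ st) (suc mx) r → Run st mx (suc mx ∷ r)
  old  : ∀ {st mx r x suf} → Pop x suf st → Run (x ∷ suf) mx r → Run st mx (x ∷ r)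

-- runs st mx n lists the runs of length n; oldRuns st mx n lists those of
-- length n+1 that start with an old step, grouped by the revisited entry.
mutual
  runs : List ℕ → ℕ → ℕ → List (List ℕ)
  runs st mx zero = [] ∷ []
  runs st mx (suc n) = map (suc mx ∷_) (runs (suc mx ∷ st) (suc mx) n) ++ oldRuns st mx n

  oldRuns : List ℕ → ℕ → ℕ → List (List ℕ)
  oldRuns [] mx n = []
  oldRuns (y ∷ ys) mx n = map (y ∷_) (runs (y ∷ ys) mx n) ++ oldRuns ys mx n

data OldRun (st : List ℕ) (mx n : ℕ) : List ℕ → Set where
  oldRun : ∀ {x suf r} → Pop x suf st → length r ≡ n → Run (x ∷ suf) mx r → OldRun st mx n (x ∷ r)

mutual
  runs-sound : ∀ st mx n {r} → r ∈ runs st mx n → length r ≡ n × Run st mx r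
  runs-sound st mx zero (here refl) = refl , done
  runs-sound st mx (suc n) r∈ with ∈-++⁻ (map (suc mx ∷_) (runs (suc mx ∷ st) (suc mx) n)) r∈
  ... | inj₁ r∈new with ∈-map⁻ (suc mx ∷_) r∈new
  ...   | r′ , r′∈ , refl with runs-sound (suc mx ∷ st) (suc mx) n r′∈
  ...     | len , run = cong suc len , new run
  runs-sound st mx (suc n) r∈ | inj₂ r∈old with oldRuns-sound st mx n r∈old
  ... | oldRun pop len run = cong suc len , old pop run

  oldRuns-sound : ∀ st mx n {r} → r ∈ oldRuns st mx n → OldRun st mx n r
  oldRuns-sound (y ∷ ys) mx n r∈ with ∈-++⁻ (map (y ∷_) (runs (y ∷ ys) mx n)) r∈
  ... | inj₁ r∈y with ∈-map⁻ (y ∷_) r∈y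
  ...   | r′ , r′∈ , refl with runs-sound (y ∷ ys) mx n r′∈
  ...     | len , run = oldRun here len run
  oldRuns-sound (y ∷ ys) mx n r∈ | inj₂ r∈ys with oldRuns-sound ys mx n r∈ys
  ... | oldRun pop len run = oldRun (there pop) len run

mutual
  runs-complete : ∀ {st mx r} → Run st mx r → r ∈ runs st mx (length r)
  runs-complete done = here refl
  runs-complete {mx = mx} (new run) =
    ∈-++⁺ˡ (∈-map⁺ (suc mx ∷_) (runs-complete run))
  runs-complete {st} {mx} (old {r = r} pop run) =
    ∈-++⁺ʳ (map (suc mx ∷_) (runs (suc mx ∷ st) (suc mx) (length r))) (oldRuns-complete pop run)

  oldRuns-complete : ∀ {st mx r x suf} → Pop x suf st → Run (x ∷ suf) mx r → (x ∷ r) ∈ oldRuns st mx (length r)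
  oldRuns-complete here run = ∈-++⁺ˡ (∈-map⁺ _ (runs-complete run))
  oldRuns-complete {y ∷ ys} {mx} {r} (there pop) run =
    ∈-++⁺ʳ (map (y ∷_) (runs (y ∷ ys) mx (length r))) (oldRuns-complete pop run)

Admissible : List ℕ → ℕ → Set
Admissible st mx = AllPairs _>_ st × All (_≤ mx) st

push-admissible : ∀ {st mx} → Admissible st mx → Admissible (suc mx ∷ st) (suc mx)
push-admissible (decreasing , bounded) =
  All.map s≤s bounded ∷ decreasing , ≤-refl ∷ All.map m≤n⇒m≤1+n bounded

off-stack-head : ∀ {h A st mx n} → ¬ h ∈ st → ∀ {v} → ¬ (v ∈ map (h ∷_) A × v ∈ oldRuns st mx n)
off-stack-head {h} h∉st (v∈ , v∈old) with ∈-map⁻ (h ∷_) v∈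
... | r , _ , refl with oldRuns-sound _ _ _ v∈old
...   | oldRun pop _ _ = h∉st (Pop⇒∈ pop)

-- The generator has no repetitions: the lists for different first letters
-- are disjoint as long as the stack is admissible.
mutual
  runs-unique : ∀ {st mx} n → Admissible st mx → Unique (runs st mx n)
  runs-unique zero adm = [] ∷ []
  runs-unique (suc n) adm@(_ , bounded) =
    Unique.++⁺ (Unique.map⁺ ∷-injectiveʳ (runs-unique n (push-admissible adm)))
               (oldRuns-unique n adm)
               (off-stack-head (λ mx+1∈st → 1+n≰n (All.lookup bounded mx+1∈st)))

  oldRuns-unique : ∀ {st mx} n → Admissible st mx → Unique (oldRuns st mx n)
  oldRuns-unique {[]} n adm = []
  oldRuns-unique {y ∷ ys} n adm@(y>ys ∷ decreasing , _ ∷ bounded) =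
    Unique.++⁺ (Unique.map⁺ ∷-injectiveʳ (runs-unique n adm))
               (oldRuns-unique n (decreasing , bounded))
               (off-stack-head (λ y∈ys → n≮n y (All.lookup y>ys y∈ys)))

mutual
  runs-length : ∀ st mx n → length (runs st mx n) ≡ nRuns (length st) n
  runs-length st mx zero = refl
  runs-length st mx (suc n) =
    trans (length-++ (map (suc mx ∷_) (runs (suc mx ∷ st) (suc mx) n)))
          (cong₂ _+_ (trans (length-map (suc mx ∷_) (runs (suc mx ∷ st) (suc mx) n))
                            (runs-length (suc mx ∷ st) (suc mx) n))
                     (oldRuns-length st mx n))

  oldRuns-length : ∀ st mx n → length (oldRuns st mx n) ≡ nOldRuns (length st) n
  oldRuns-length [] mx n = refl
  oldRuns-length (y ∷ ys) mx n =
    trans (length-++ (map (y ∷_) (runs (y ∷ ys) mx n)))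
          (cong₂ _+_ (trans (length-map (y ∷_) (runs (y ∷ ys) mx n)) (runs-length (y ∷ ys) mx n))
                     (oldRuns-length ys mx n))

ascentAt : ℕ → ℕ → ℕ
ascentAt l x = if l <ᵇ x then 1 else 0

ascentAt-< : ∀ {l x} → l < x → ascentAt l x ≡ 1
ascentAt-< {l} {x} l<x with l <ᵇ x | <⇒<ᵇ l<x
... | true | _ = refl

ascentAt-≥ : ∀ {l x} → x ≤ l → ascentAt l x ≡ 0
ascentAt-≥ {l} {x} x≤l with l <ᵇ x | <ᵇ⇒< l x
... | false | _ = refl
... | true | l<x = ⊥-elim (<⇒≱ (l<x _) x≤l)

asc-ascent : ∀ {l x} → l < x → ∀ r → asc (l ∷ x ∷ r) ≡ suc (asc (x ∷ r))
asc-ascent l<x r = cong (_+ asc (_ ∷ r)) (ascentAt-< l<x)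

asc-descent : ∀ {l x} → x ≤ l → ∀ r → asc (l ∷ x ∷ r) ≡ asc (x ∷ r)
asc-descent x≤l r = cong (_+ asc (_ ∷ r)) (ascentAt-≥ x≤l)

length-filter-++ : ∀ {A : Set} {P : Pred A 0ℓ} (P? : Decidable P) xs ys →
  length (filter P? (xs ++ ys)) ≡ length (filter P? xs) + length (filter P? ys)
length-filter-++ P? xs ys = trans (cong length (filter-++ P? xs ys)) (length-++ (filter P? xs))

length-filter-map : ∀ {A B : Set} {P : Pred B 0ℓ} (P? : Decidable P) (f : A → B) xs →
  length (filter P? (map f xs)) ≡ length (filter (P? ∘ f) xs)
length-filter-map P? f [] = refl
length-filter-map P? f (x ∷ xs) with does (P? (f x))
... | true = cong suc (length-filter-map P? f xs)
... | false = length-filter-map P? f xs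

hasAsc? : ∀ l k → Decidable (λ r → asc (l ∷ r) ≡ k)
hasAsc? l k r = asc (l ∷ r) ≟ k

count-ascent : ∀ {l x} → l < x → ∀ k A →
  length (filter (hasAsc? l (suc k)) (map (x ∷_) A)) ≡ length (filter (hasAsc? x k) A)
count-ascent {l} {x} l<x k A =
  trans (length-filter-map (hasAsc? l (suc k)) (x ∷_) A)
        (cong length (filter-≐ _ (hasAsc? x k) ((λ {r} p → suc-injective (trans (sym (asc-ascent l<x r)) p))
                                              , (λ {r} q → trans (asc-ascent l<x r) (cong suc q))) A))

count-ascent-zero : ∀ {l x} → l < x → ∀ A → length (filter (hasAsc? l 0) (map (x ∷_) A)) ≡ 0
count-ascent-zero {l} {x} l<x A =
  trans (length-filter-map (hasAsc? l 0) (x ∷_) A)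
        (cong length (filter-none _ (All.universal (λ r p → 1+n≢0 (trans (sym (asc-ascent l<x r)) p)) A)))

count-descent : ∀ {l x} → x ≤ l → ∀ k A →
  length (filter (hasAsc? l k) (map (x ∷_) A)) ≡ length (filter (hasAsc? x k) A)
count-descent {l} {x} x≤l k A =
  trans (length-filter-map (hasAsc? l k) (x ∷_) A)
        (cong length (filter-≐ _ (hasAsc? x k) ((λ {r} → trans (sym (asc-descent x≤l r)))
                                              , (λ {r} → trans (asc-descent x≤l r))) A))

-- Along a run every ascent is a new maximum: so the runs of length n with k
-- ascents, after the top l of an admissible stack, are counted by nRunsAsc.
mutual
  runs-ascents : ∀ {l st mx} n k → Admissible (l ∷ st) mx →
    length (filter (hasAsc? l k) (runs (l ∷ st) mx n)) ≡ nRunsAsc (suc (length st)) n k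
  runs-ascents zero zero adm = refl
  runs-ascents zero (suc k) adm = refl
  runs-ascents {l} {st} {mx} (suc n) zero adm@(l>st ∷ _ , l≤mx ∷ _) =
    trans (length-filter-++ (hasAsc? l 0) (map (suc mx ∷_) (runs (suc mx ∷ l ∷ st) (suc mx) n)) (oldRuns (l ∷ st) mx n))
          (cong₂ _+_ (count-ascent-zero (s≤s l≤mx) (runs (suc mx ∷ l ∷ st) (suc mx) n))
                     (oldRuns-ascents n 0 adm (≤-refl ∷ All.map <⇒≤ l>st)))
  runs-ascents {l} {st} {mx} (suc n) (suc k) adm@(l>st ∷ _ , l≤mx ∷ _) =
    trans (length-filter-++ (hasAsc? l (suc k)) (map (suc mx ∷_) (runs (suc mx ∷ l ∷ st) (suc mx) n)) (oldRuns (l ∷ st) mx n))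
          (cong₂ _+_ (trans (count-ascent (s≤s l≤mx) k (runs (suc mx ∷ l ∷ st) (suc mx) n))
                            (runs-ascents n k (push-admissible adm)))
                     (oldRuns-ascents n (suc k) adm (≤-refl ∷ All.map <⇒≤ l>st)))

  oldRuns-ascents : ∀ {l st mx} n k → Admissible st mx → All (_≤ l) st →
    length (filter (hasAsc? l k) (oldRuns st mx n)) ≡ nOldRunsAsc (length st) n k
  oldRuns-ascents {st = []} n k adm below = refl
  oldRuns-ascents {l} {y ∷ ys} {mx} n k adm@(_ ∷ decreasing , _ ∷ bounded) (y≤l ∷ below) =
    trans (length-filter-++ (hasAsc? l k) (map (y ∷_) (runs (y ∷ ys) mx n)) (oldRuns ys mx n))
          (cong₂ _+_ (trans (count-descent y≤l k (runs (y ∷ ys) mx n)) (runs-ascents n k adm))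
                     (oldRuns-ascents n k (decreasing , bounded) below))

module _ {f : ℕ → ℕ} (mono : ∀ {x y} → x < y → f x < f y) where

  mono-reflects : ∀ x y → ((f x < f y) ⇔ (x < y)) × ((f x ≡ f y) ⇔ (x ≡ y))
  mono-reflects x y with <-cmp x y
  ... | tri< x<y _ _ = mk⇔ (λ _ → x<y) (λ _ → mono x<y)
                     , mk⇔ (λ fx≡fy → ⊥-elim (<-irrefl fx≡fy (mono x<y))) (λ x≡y → ⊥-elim (<-irrefl x≡y x<y))
  ... | tri≈ _ refl _ = mk⇔ (λ fx<fx → ⊥-elim (<-irrefl refl fx<fx)) (λ x<x → ⊥-elim (<-irrefl refl x<x))
                      , mk⇔ (λ _ → refl) (λ _ → refl)
  ... | tri> _ _ y<x = mk⇔ (λ fx<fy → ⊥-elim (<-asym fx<fy (mono y<x))) (λ x<y → ⊥-elim (<-asym x<y y<x))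
                     , mk⇔ (λ fx≡fy → ⊥-elim (<-irrefl (sym fx≡fy) (mono y<x))) (λ x≡y → ⊥-elim (<-irrefl (sym x≡y) y<x))

  lookup-map : ∀ p (i : Fin (length (map f p))) → lookup (map f p) i ≡ f (lookup p (cast (length-map f p) i))
  lookup-map (x ∷ p) zero = refl
  lookup-map (x ∷ p) (suc i) = lookup-map p i

  orderIso-map : ∀ p → OrderIso (map f p) p
  orderIso-map p = length-map f p , λ a b →
    subst₂ (λ u v → ((u < v) ⇔ (at a < at b)) × ((u ≡ v) ⇔ (at a ≡ at b)))
           (sym (lookup-map p a)) (sym (lookup-map p b)) (mono-reflects (at a) (at b))
    where
    at : Fin (length (map f p)) → ℕ
    at i = lookup p (cast (length-map f p) i)

-- The increasing map sending 0 to c and 1 to d (c < d): it realises the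
-- binary patterns 101 and 0101 on the two values c and d.
twoLevels : ℕ → ℕ → ℕ → ℕ
twoLevels c d zero = c
twoLevels c d (suc i) = i + d

twoLevels-mono : ∀ {c d} → c < d → ∀ {x y} → x < y → twoLevels c d x < twoLevels c d y
twoLevels-mono {d = d} c<d {zero} {suc j} _ = <-≤-trans c<d (m≤n+m d j)
twoLevels-mono {d = d} c<d {suc i} {suc j} (s≤s i<j) = +-monoˡ-< d i<j

Av101 : List ℕ → Set
Av101 xs = ∀ a b → b < a → ¬ ((a ∷ b ∷ a ∷ []) ⊆ xs)

Av0101 : List ℕ → Set
Av0101 xs = ∀ c d → c < d → ¬ ((c ∷ d ∷ c ∷ d ∷ []) ⊆ xs)

occurrence-101 : ∀ w → OrderIso w (1 ∷ 0 ∷ 1 ∷ []) → ∃[ a ] ∃[ b ] (w ≡ a ∷ b ∷ a ∷ [] × b < a)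
occurrence-101 (a ∷ b ∷ c ∷ []) (_ , iso) with Equivalence.from (proj₂ (iso zero (suc (suc zero)))) refl
... | refl = a , b , refl , Equivalence.from (proj₁ (iso (suc zero) zero)) (s≤s z≤n)

occurrence-0101 : ∀ w → OrderIso w (0 ∷ 1 ∷ 0 ∷ 1 ∷ []) → ∃[ c ] ∃[ d ] (w ≡ c ∷ d ∷ c ∷ d ∷ [] × c < d)
occurrence-0101 (a ∷ b ∷ c ∷ d ∷ []) (_ , iso)
  with Equivalence.from (proj₂ (iso zero (suc (suc zero)))) refl
     | Equivalence.from (proj₂ (iso (suc zero) (suc (suc (suc zero))))) refl
... | refl | refl = a , b , refl , Equivalence.from (proj₁ (iso zero (suc zero))) (s≤s z≤n)

Avoids101⇔Av101 : ∀ xs → Avoids (1 ∷ 0 ∷ 1 ∷ []) xs ⇔ Av101 xs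
Avoids101⇔Av101 xs = mk⇔
  (λ avoids a b b<a sub → avoids (_ , sub , orderIso-map (twoLevels-mono b<a) (1 ∷ 0 ∷ 1 ∷ [])))
  (λ { av (w , sub , iso) → case-101 av sub (occurrence-101 w iso) })
  where
  case-101 : ∀ {w} → Av101 xs → w ⊆ xs → ∃[ a ] ∃[ b ] (w ≡ a ∷ b ∷ a ∷ [] × b < a) → ⊥
  case-101 av sub (a , b , refl , b<a) = av a b b<a sub

Avoids0101⇔Av0101 : ∀ xs → Avoids (0 ∷ 1 ∷ 0 ∷ 1 ∷ []) xs ⇔ Av0101 xs
Avoids0101⇔Av0101 xs = mk⇔
  (λ avoids c d c<d sub → avoids (_ , sub , orderIso-map (twoLevels-mono c<d) (0 ∷ 1 ∷ 0 ∷ 1 ∷ [])))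
  (λ { av (w , sub , iso) → case-0101 av sub (occurrence-0101 w iso) })
  where
  case-0101 : ∀ {w} → Av0101 xs → w ⊆ xs → ∃[ c ] ∃[ d ] (w ≡ c ∷ d ∷ c ∷ d ∷ [] × c < d) → ⊥
  case-0101 av sub (c , d , refl , c<d) = av c d c<d sub

Av101⇒Av0101 : ∀ {xs} → Av101 xs → Av0101 xs
Av101⇒Av0101 av c d c<d sub = av d c c<d (⊆-trans (c ∷ʳ ⊆-refl) sub)

⊆-snoc⁻ : ∀ {ys} (p : List ℕ) x → ys ⊆ p ++ [ x ] → ys ⊆ p ⊎ ∃[ zs ] (ys ≡ zs ++ [ x ] × zs ⊆ p)
⊆-snoc⁻ [] x (.x ∷ʳ []) = inj₁ []
⊆-snoc⁻ [] x (refl ∷ []) = inj₂ ([] , refl , [])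
⊆-snoc⁻ (y ∷ p) x (.y ∷ʳ s) with ⊆-snoc⁻ p x s
... | inj₁ s′ = inj₁ (y ∷ʳ s′)
... | inj₂ (zs , eq , s′) = inj₂ (zs , eq , y ∷ʳ s′)
⊆-snoc⁻ (y ∷ p) x (refl ∷ s) with ⊆-snoc⁻ p x s
... | inj₁ s′ = inj₁ (refl ∷ s′)
... | inj₂ (zs , refl , s′) = inj₂ (y ∷ zs , refl , refl ∷ s′)

pair-snoc⁻ : ∀ {a b} (p : List ℕ) x → (a ∷ b ∷ []) ⊆ p ++ [ x ] → (a ∷ b ∷ []) ⊆ p ⊎ (a ∈ p × b ≡ x)
pair-snoc⁻ {a} p x s with ⊆-snoc⁻ p x s
... | inj₁ s′ = inj₁ s′
... | inj₂ (zs , eq , s′) with ∷ʳ-injective (a ∷ []) zs eq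
...   | refl , b≡x = inj₂ (to∈ s′ , b≡x)

triple-snoc⁻ : ∀ {a b c} (p : List ℕ) x → (a ∷ b ∷ c ∷ []) ⊆ p ++ [ x ] → (a ∷ b ∷ c ∷ []) ⊆ p ⊎ ((a ∷ b ∷ []) ⊆ p × c ≡ x)
triple-snoc⁻ {a} {b} p x s with ⊆-snoc⁻ p x s
... | inj₁ s′ = inj₁ s′
... | inj₂ (zs , eq , s′) with ∷ʳ-injective (a ∷ b ∷ []) zs eq
...   | refl , c≡x = inj₂ (s′ , c≡x)

∈-snoc⁻ : ∀ {v} (p : List ℕ) x → v ∈ p ++ [ x ] → v ∈ p ⊎ v ≡ x
∈-snoc⁻ p x v∈ with ∈-++⁻ p v∈
... | inj₁ v∈p = inj₁ v∈p
... | inj₂ (here v≡x) = inj₂ v≡x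

⊆-snoc : ∀ {xs ys : List ℕ} x → xs ⊆ ys → xs ++ [ x ] ⊆ ys ++ [ x ]
⊆-snoc x s = Sublistₚ.++⁺ s ⊆-refl

⊆-extend : ∀ {xs ys : List ℕ} x → xs ⊆ ys → xs ⊆ ys ++ [ x ]
⊆-extend x = Sublistₚ.++⁺ʳ [ x ]

⊆-prefix : ∀ (p : List ℕ) x r → p ++ [ x ] ⊆ p ++ x ∷ r
⊆-prefix p x r = Sublistₚ.++⁺ ⊆-refl (refl ∷ minimum r)

pair-last : ∀ {v} (p : List ℕ) x → v ∈ p → (v ∷ x ∷ []) ⊆ p ++ [ x ]
pair-last p x v∈p = ⊆-snoc x (from∈ v∈p)

Av101-mono : ∀ {p q} → p ⊆ q → Av101 q → Av101 p
Av101-mono s av a b b<a t = av a b b<a (⊆-trans t s)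

-- Reading a 101-avoiding ascent sequence letter by
-- letter, p is the prefix read so far, its values are exactly 0,…,mx, and the
-- stack l ∷ st (top l = last letter of p) holds the values v that are still
-- "open": not yet followed by a smaller letter, so that v may be repeated
-- without creating 101.  The field descent-repeats serves the 0101 claim,
-- and smaller-first is what keeps it invariant.
record Tracks (p : List ℕ) (l : ℕ) (st : List ℕ) (mx : ℕ) : Set where
  field
    decreasing      : AllPairs _>_ (l ∷ st)
    stack⊆prefix    : ∀ {v} → v ∈ l ∷ st → v ∈ p
    bounded         : ∀ {v} → v ∈ p → v ≤ mx
    covers          : ∀ {v} → v ≤ mx → v ∈ p
    avoids          : Av101 p
    closed          : ∀ {v} → v ≤ mx → ¬ v ∈ l ∷ st → ∃[ b ] (b < v × (v ∷ b ∷ []) ⊆ p)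
    descent-closes  : ∀ {a b} → b < a → (a ∷ b ∷ []) ⊆ p → ¬ a ∈ l ∷ st
    descent-repeats : ∀ {a b} → b < a → (a ∷ b ∷ []) ⊆ p → (b ∷ a ∷ b ∷ []) ⊆ p
    smaller-first   : ∀ {a b} → b < a → a ∈ p → (b ∷ a ∷ []) ⊆ p

open Tracks

top≤max : ∀ {p l st mx} → Tracks p l st mx → l ≤ mx
top≤max T = bounded T (stack⊆prefix T (here refl))

Tracks-start : Tracks (0 ∷ []) 0 [] 0
Tracks-start = record
  { decreasing      = [] ∷ []
  ; stack⊆prefix    = λ v∈ → v∈
  ; bounded         = λ { (here refl) → z≤n }
  ; covers          = λ { z≤n → here refl }
  ; avoids          = λ { a b b<a (refl ∷ ()) ; a b b<a (_ ∷ʳ ()) }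
  ; closed          = λ { z≤n 0∉ → ⊥-elim (0∉ (here refl)) }
  ; descent-closes  = λ { b<a (refl ∷ ()) ; b<a (_ ∷ʳ ()) }
  ; descent-repeats = λ { b<a (refl ∷ ()) ; b<a (_ ∷ʳ ()) }
  ; smaller-first   = λ { () (here refl) }
  }

Tracks-push : ∀ {p l st mx} → Tracks p l st mx → Tracks (p ++ [ suc mx ]) (suc mx) (l ∷ st) (suc mx)
Tracks-push {p} {l} {st} {mx} T = record
  { decreasing      = All.tabulate (λ v∈ → s≤s (bounded T (stack⊆prefix T v∈))) ∷ decreasing T
  ; stack⊆prefix    = λ { (here refl) → ∈-++⁺ʳ p (here refl) ; (there v∈) → ∈-++⁺ˡ (stack⊆prefix T v∈) }
  ; bounded         = bounded′
  ; covers          = covers′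
  ; avoids          = avoids′
  ; closed          = closed′
  ; descent-closes  = descent-closes′
  ; descent-repeats = descent-repeats′
  ; smaller-first   = smaller-first′
  }
  where
  x : ℕ
  x = suc mx
  x∉p : ¬ x ∈ p
  x∉p x∈p = 1+n≰n (bounded T x∈p)
  bounded′ : ∀ {v} → v ∈ p ++ [ x ] → v ≤ x
  bounded′ v∈ with ∈-snoc⁻ p x v∈
  ... | inj₁ v∈p = m≤n⇒m≤1+n (bounded T v∈p)
  ... | inj₂ refl = ≤-refl
  covers′ : ∀ {v} → v ≤ x → v ∈ p ++ [ x ]
  covers′ v≤x with m≤n⇒m<n∨m≡n v≤x
  ... | inj₁ (s≤s v≤mx) = ∈-++⁺ˡ (covers T v≤mx)
  ... | inj₂ refl = ∈-++⁺ʳ p (here refl)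
  avoids′ : Av101 (p ++ [ x ])
  avoids′ a b b<a s with triple-snoc⁻ p x s
  ... | inj₁ s′ = avoids T a b b<a s′
  ... | inj₂ (s′ , refl) = x∉p (Sublist.lookup s′ (here refl))
  closed′ : ∀ {v} → v ≤ x → ¬ v ∈ x ∷ l ∷ st → ∃[ b ] (b < v × (v ∷ b ∷ []) ⊆ p ++ [ x ])
  closed′ v≤x v∉ with m≤n⇒m<n∨m≡n v≤x
  ... | inj₂ refl = ⊥-elim (v∉ (here refl))
  ... | inj₁ (s≤s v≤mx) with closed T v≤mx (λ v∈ → v∉ (there v∈))
  ...   | b , b<v , s = b , b<v , ⊆-extend x s
  descent-closes′ : ∀ {a b} → b < a → (a ∷ b ∷ []) ⊆ p ++ [ x ] → ¬ a ∈ x ∷ l ∷ st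
  descent-closes′ b<a s a∈ with pair-snoc⁻ p x s
  ... | inj₂ (a∈p , refl) = <⇒≱ b<a (m≤n⇒m≤1+n (bounded T a∈p))
  ... | inj₁ s′ with a∈
  ...   | here refl = x∉p (Sublist.lookup s′ (here refl))
  ...   | there a∈st = descent-closes T b<a s′ a∈st
  descent-repeats′ : ∀ {a b} → b < a → (a ∷ b ∷ []) ⊆ p ++ [ x ] → (b ∷ a ∷ b ∷ []) ⊆ p ++ [ x ]
  descent-repeats′ b<a s with pair-snoc⁻ p x s
  ... | inj₁ s′ = ⊆-extend x (descent-repeats T b<a s′)
  ... | inj₂ (a∈p , refl) = ⊥-elim (<⇒≱ b<a (m≤n⇒m≤1+n (bounded T a∈p)))
  smaller-first′ : ∀ {a b} → b < a → a ∈ p ++ [ x ] → (b ∷ a ∷ []) ⊆ p ++ [ x ]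
  smaller-first′ b<a a∈ with ∈-snoc⁻ p x a∈
  ... | inj₁ a∈p = ⊆-extend x (smaller-first T b<a a∈p)
  smaller-first′ (s≤s b≤mx) a∈ | inj₂ refl = pair-last p x (covers T b≤mx)

Tracks-pop : ∀ {p l st mx x suf} → Tracks p l st mx → Pop x suf (l ∷ st) → Tracks (p ++ [ x ]) x suf mx
Tracks-pop {p} {l} {st} {mx} {x} {suf} T pop = record
  { decreasing      = Pop-decreasing (decreasing T) pop
  ; stack⊆prefix    = λ v∈ → ∈-++⁺ˡ (stack⊆prefix T (Pop-⊆ pop v∈))
  ; bounded         = bounded′
  ; covers          = λ v≤mx → ∈-++⁺ˡ (covers T v≤mx)
  ; avoids          = avoids′
  ; closed          = closed′
  ; descent-closes  = descent-closes′
  ; descent-repeats = descent-repeats′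
  ; smaller-first   = smaller-first′
  }
  where
  x∈st : x ∈ l ∷ st
  x∈st = Pop⇒∈ pop
  x∈p : x ∈ p
  x∈p = stack⊆prefix T x∈st
  bounded′ : ∀ {v} → v ∈ p ++ [ x ] → v ≤ mx
  bounded′ v∈ with ∈-snoc⁻ p x v∈
  ... | inj₁ v∈p = bounded T v∈p
  ... | inj₂ refl = bounded T x∈p
  -- a 101 ending in the new letter x would need x to be closed already
  avoids′ : Av101 (p ++ [ x ])
  avoids′ a b b<a s with triple-snoc⁻ p x s
  ... | inj₁ s′ = avoids T a b b<a s′
  ... | inj₂ (s′ , refl) = descent-closes T b<a s′ x∈st
  -- the entries popped above x are now closed by the smaller letter x
  closed′ : ∀ {v} → v ≤ mx → ¬ v ∈ x ∷ suf → ∃[ b ] (b < v × (v ∷ b ∷ []) ⊆ p ++ [ x ])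
  closed′ {v} v≤mx v∉ with v ∈? (l ∷ st)
  ... | no v∉st with closed T v≤mx v∉st
  ...   | b , b<v , s = b , b<v , ⊆-extend x s
  closed′ {v} v≤mx v∉ | yes v∈st with v ≤? x
  ...   | yes v≤x = ⊥-elim (v∉ (Pop-keeps (decreasing T) pop v∈st v≤x))
  ...   | no v≰x = x , ≰⇒> v≰x , pair-last p x (stack⊆prefix T v∈st)
  descent-closes′ : ∀ {a b} → b < a → (a ∷ b ∷ []) ⊆ p ++ [ x ] → ¬ a ∈ x ∷ suf
  descent-closes′ b<a s a∈ with pair-snoc⁻ p x s
  ... | inj₁ s′ = descent-closes T b<a s′ (Pop-⊆ pop a∈)
  ... | inj₂ (_ , refl) = <⇒≱ b<a (top-max (Pop-decreasing (decreasing T) pop) a∈)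
  descent-repeats′ : ∀ {a b} → b < a → (a ∷ b ∷ []) ⊆ p ++ [ x ] → (b ∷ a ∷ b ∷ []) ⊆ p ++ [ x ]
  descent-repeats′ b<a s with pair-snoc⁻ p x s
  ... | inj₁ s′ = ⊆-extend x (descent-repeats T b<a s′)
  ... | inj₂ (a∈p , refl) = ⊆-snoc x (smaller-first T b<a a∈p)
  smaller-first′ : ∀ {a b} → b < a → a ∈ p ++ [ x ] → (b ∷ a ∷ []) ⊆ p ++ [ x ]
  smaller-first′ b<a a∈ with ∈-snoc⁻ p x a∈
  ... | inj₁ a∈p = ⊆-extend x (smaller-first T b<a a∈p)
  ... | inj₂ refl = ⊆-extend x (smaller-first T b<a x∈p)

next-letter : ∀ {p l st mx x} → Tracks p l st mx → x ≤ suc mx → Av101 (p ++ [ x ]) →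
              x ≡ suc mx ⊎ ∃[ suf ] Pop x suf (l ∷ st)
next-letter {l = l} {st} {x = x} T x≤1+mx av with m≤n⇒m<n∨m≡n x≤1+mx
... | inj₂ x≡1+mx = inj₁ x≡1+mx
... | inj₁ (s≤s x≤mx) with x ∈? (l ∷ st)
...   | yes x∈st = inj₂ (∈⇒Pop x∈st)
...   | no x∉st with closed T x≤mx x∉st
...     | b , b<x , s = ⊥-elim (av x b b<x (⊆-snoc x s))

-- The ascent condition in recursive form: AscentTail c l r says that r may
-- follow a prefix ending in l with c ascents.
AscentTail : ℕ → ℕ → List ℕ → Set
AscentTail c l [] = ⊤
AscentTail c l (x ∷ r) = x ≤ suc c × AscentTail (c + ascentAt l x) x r

AscentTail⇒bounds : ∀ c l r → AscentTail c l r →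
  ∀ (i : Fin (length r)) → lookup r i ≤ suc (c + asc (take (suc (toℕ i)) (l ∷ r)))
AscentTail⇒bounds c l (x ∷ r) (x≤ , _) zero = subst (λ u → x ≤ suc u) (sym (+-identityʳ c)) x≤
AscentTail⇒bounds c l (x ∷ r) (_ , tail) (suc i) =
  subst (λ u → lookup r i ≤ suc u) (+-assoc c (ascentAt l x) (asc (take (suc (toℕ i)) (x ∷ r))))
        (AscentTail⇒bounds (c + ascentAt l x) x r tail i)

bounds⇒AscentTail : ∀ c l r →
  (∀ (i : Fin (length r)) → lookup r i ≤ suc (c + asc (take (suc (toℕ i)) (l ∷ r)))) → AscentTail c l r
bounds⇒AscentTail c l [] bounds = tt
bounds⇒AscentTail c l (x ∷ r) bounds =
  subst (λ u → x ≤ suc u) (+-identityʳ c) (bounds zero) ,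
  bounds⇒AscentTail (c + ascentAt l x) x r (λ i →
    subst (λ u → lookup r i ≤ suc u) (sym (+-assoc c (ascentAt l x) (asc (take (suc (toℕ i)) (x ∷ r)))))
          (bounds (suc i)))

IsAscentSeq⇒AscentTail : ∀ xs → IsAscentSeq xs → ∃[ r ] (xs ≡ 0 ∷ r × AscentTail 0 0 r)
IsAscentSeq⇒AscentTail .(0 ∷ r) ((r , refl) , bounds) =
  r , refl , bounds⇒AscentTail 0 0 r (λ i → bounds (suc i) (s≤s z≤n))

AscentTail⇒IsAscentSeq : ∀ r → AscentTail 0 0 r → IsAscentSeq (0 ∷ r)
AscentTail⇒IsAscentSeq r tail = (r , refl) , bounds
  where
  bounds : ∀ (i : Fin (length (0 ∷ r))) → 0 < toℕ i → lookup (0 ∷ r) i ≤ suc (asc (take (toℕ i) (0 ∷ r)))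
  bounds (suc i) _ = AscentTail⇒bounds 0 0 r tail i

-- Along the scan the number of ascents equals the current maximum: a new
-- maximum is an ascent, a repeated stack entry is not.
ascents-push : ∀ {p l st mx} → Tracks p l st mx → mx + ascentAt l (suc mx) ≡ suc mx
ascents-push T = trans (cong (_ +_) (ascentAt-< (s≤s (top≤max T)))) (+-comm _ 1)

ascents-pop : ∀ {p l st mx x suf} → Tracks p l st mx → Pop x suf (l ∷ st) → mx + ascentAt l x ≡ mx
ascents-pop T pop = trans (cong (_ +_) (ascentAt-≥ (top-max (decreasing T) (Pop⇒∈ pop)))) (+-identityʳ _)

snoc-++ : ∀ (p : List ℕ) x r → (p ++ [ x ]) ++ r ≡ p ++ x ∷ r
snoc-++ p x r = ++-assoc p [ x ] r

run⇒avoider : ∀ {p l st mx r} → Tracks p l st mx → Run (l ∷ st) mx r → AscentTail mx l r × Av101 (p ++ r)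
run⇒avoider {p} T done = tt , subst Av101 (sym (++-identityʳ p)) (avoids T)
run⇒avoider {p} {mx = mx} {r = .(suc mx) ∷ r} T (new run) with run⇒avoider (Tracks-push T) run
... | tail , av = (≤-refl , subst (λ c → AscentTail c (suc mx) r) (sym (ascents-push T)) tail)
                , subst Av101 (snoc-++ p (suc mx) r) av
run⇒avoider {p} {r = x ∷ r} T (old pop run) with run⇒avoider (Tracks-pop T pop) run
... | tail , av = (m≤n⇒m≤1+n (bounded T (stack⊆prefix T (Pop⇒∈ pop)))
                   , subst (λ c → AscentTail c x r) (sym (ascents-pop T pop)) tail)
                , subst Av101 (snoc-++ p x r) av

avoider⇒run : ∀ {p l st mx} r → Tracks p l st mx → AscentTail mx l r → Av101 (p ++ r) → Run (l ∷ st) mx r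
avoider⇒run [] T tail av = done
avoider⇒run {p} (x ∷ r) T (x≤ , tail) av
  with next-letter T x≤ (Av101-mono (⊆-prefix p x r) av)
... | inj₁ refl = new (avoider⇒run r (Tracks-push T)
                        (subst (λ c → AscentTail c x r) (ascents-push T) tail)
                        (subst Av101 (sym (snoc-++ p x r)) av))
... | inj₂ (suf , pop) = old pop (avoider⇒run r (Tracks-pop T pop)
                        (subst (λ c → AscentTail c x r) (ascents-pop T pop) tail)
                        (subst Av101 (sym (snoc-++ p x r)) av))

-- For continuations satisfying the ascent condition, avoiding 0101 already
-- forces avoiding 101: a 101 completed by the new letter would, through
-- descent-repeats, extend to a 0101.
Av0101⇒Av101 : ∀ {p l st mx} r → Tracks p l st mx → AscentTail mx l r → Av0101 (p ++ r) → Av101 (p ++ r)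
Av0101⇒Av101 {p} [] T tail av0 = subst Av101 (sym (++-identityʳ p)) (avoids T)
Av0101⇒Av101 {p} (x ∷ r) T (x≤ , tail) av0 = subst Av101 (snoc-++ p x r) rest
  where
  step : Av101 (p ++ [ x ])
  step a b b<a s with triple-snoc⁻ p x s
  ... | inj₁ s′ = avoids T a b b<a s′
  ... | inj₂ (s′ , refl) = av0 b a b<a (⊆-trans (⊆-snoc x (descent-repeats T b<a s′)) (⊆-prefix p x r))
  av0′ : Av0101 ((p ++ [ x ]) ++ r)
  av0′ = subst Av0101 (sym (snoc-++ p x r)) av0
  rest : Av101 ((p ++ [ x ]) ++ r)
  rest with next-letter T x≤ step
  ... | inj₁ refl = Av0101⇒Av101 r (Tracks-push T) (subst (λ c → AscentTail c x r) (ascents-push T) tail) av0′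
  ... | inj₂ (suf , pop) = Av0101⇒Av101 r (Tracks-pop T pop)
          (subst (λ c → AscentTail c x r) (ascents-pop T pop) tail) av0′

Enumerates : (List ℕ → Set) → List (List ℕ) → Set
Enumerates P L = Unique L × (∀ xs → (xs ∈ L) ⇔ P xs)

counted : ∀ {P L c} → Enumerates P L → length L ≡ c → HasCount P c
counted {L = L} (unique , members) len = L , unique , members , len

Enumerates-filter : ∀ {P Q L} → Enumerates P L → (Q? : Decidable Q) →
                    Enumerates (λ xs → P xs × Q xs) (filter Q? L)
Enumerates-filter (unique , members) Q? = Unique.filter⁺ Q? unique , λ xs →
  mk⇔ (λ xs∈ → let (xs∈L , qxs) = ∈-filter⁻ Q? xs∈ in Equivalence.to (members xs) xs∈L , qxs)
      (λ (pxs , qxs) → ∈-filter⁺ Q? (Equivalence.from (members xs) pxs) qxs)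

Enumerates-⇔ : ∀ {P Q L} → (∀ xs → P xs ⇔ Q xs) → Enumerates P L → Enumerates Q L
Enumerates-⇔ P⇔Q (unique , members) = unique , λ xs →
  mk⇔ (Equivalence.to (P⇔Q xs) ∘ Equivalence.to (members xs)) (Equivalence.from (members xs) ∘ Equivalence.from (P⇔Q xs))

AvoidingAscentSeq : ℕ → List ℕ → Set
AvoidingAscentSeq m xs = (length xs ≡ suc m) × IsAscentSeq xs × Avoids (1 ∷ 0 ∷ 1 ∷ []) xs

avoiders : ℕ → List (List ℕ)
avoiders m = map (0 ∷_) (runs (0 ∷ []) 0 m)

initial-admissible : Admissible (0 ∷ []) 0
initial-admissible = [] ∷ [] , z≤n ∷ []

avoiders-enumerate : ∀ m → Enumerates (AvoidingAscentSeq m) (avoiders m)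
avoiders-enumerate m = Unique.map⁺ ∷-injectiveʳ (runs-unique m initial-admissible) , λ xs → mk⇔ (sound xs) (complete xs)
  where
  sound : ∀ xs → xs ∈ avoiders m → AvoidingAscentSeq m xs
  sound xs xs∈ with ∈-map⁻ (0 ∷_) xs∈
  ... | r , r∈ , refl with runs-sound (0 ∷ []) 0 m r∈
  ...   | len , run with run⇒avoider Tracks-start run
  ...     | tail , av = cong suc len , AscentTail⇒IsAscentSeq r tail , Equivalence.from (Avoids101⇔Av101 xs) av
  complete : ∀ xs → AvoidingAscentSeq m xs → xs ∈ avoiders m
  complete xs (len , asc-seq , avoids) with IsAscentSeq⇒AscentTail xs asc-seq
  ... | r , refl , tail =
    ∈-map⁺ (0 ∷_) (subst (λ n → r ∈ runs (0 ∷ []) 0 n) (suc-injective len)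
      (runs-complete (avoider⇒run r Tracks-start tail (Equivalence.to (Avoids101⇔Av101 xs) avoids))))

avoiders-length : ∀ m → length (avoiders m) ≡ catalan (suc m)
avoiders-length m = begin
  length (map (0 ∷_) (runs (0 ∷ []) 0 m)) ≡⟨ length-map (0 ∷_) (runs (0 ∷ []) 0 m) ⟩
  length (runs (0 ∷ []) 0 m)              ≡⟨ runs-length (0 ∷ []) 0 m ⟩
  nRuns 1 m                               ≡⟨ catalan-nRuns m ⟩
  catalan (suc m)                         ∎

avoiders-ascents : ∀ m k → length (filter (λ xs → asc xs ≟ k) (avoiders m)) ≡ narayana m (suc k)
avoiders-ascents m k = begin
  length (filter (λ xs → asc xs ≟ k) (map (0 ∷_) (runs (0 ∷ []) 0 m)))
    ≡⟨ length-filter-map (λ xs → asc xs ≟ k) (0 ∷_) (runs (0 ∷ []) 0 m) ⟩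
  length (filter (hasAsc? 0 k) (runs (0 ∷ []) 0 m)) ≡⟨ runs-ascents m k initial-admissible ⟩
  nRunsAsc 1 m k                                    ≡⟨ narayana-nRunsAsc m k ⟩
  narayana m (suc k)                                ∎

avoiders-with-ascents : ∀ m k →
  Enumerates (λ xs → (length xs ≡ suc m) × IsAscentSeq xs × Avoids (1 ∷ 0 ∷ 1 ∷ []) xs × (asc xs ≡ k))
             (filter (λ xs → asc xs ≟ k) (avoiders m))
avoiders-with-ascents m k =
  Enumerates-⇔ (λ xs → mk⇔ (λ ((len , asc-seq , avoids) , ascents) → len , asc-seq , avoids , ascents)
                           (λ (len , asc-seq , avoids , ascents) → (len , asc-seq , avoids) , ascents))
               (Enumerates-filter (avoiders-enumerate m) (λ xs → asc xs ≟ k))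

avoidance-equivalence : (xs : List ℕ) → IsAscentSeq xs →
  (Avoids (1 ∷ 0 ∷ 1 ∷ []) xs ⇔ Avoids (0 ∷ 1 ∷ 0 ∷ 1 ∷ []) xs)
avoidance-equivalence xs asc-seq = mk⇔
  (λ avoids → Equivalence.from (Avoids0101⇔Av0101 xs) (Av101⇒Av0101 (Equivalence.to (Avoids101⇔Av101 xs) avoids)))
  (λ avoids → Equivalence.from (Avoids101⇔Av101 xs) (from-0101 (Equivalence.to (Avoids0101⇔Av0101 xs) avoids)))
  where
  from-0101 : Av0101 xs → Av101 xs
  from-0101 av0 with IsAscentSeq⇒AscentTail xs asc-seq
  ... | r , refl , tail = Av0101⇒Av101 r Tracks-start tail av0

theorem2p5 :
    ((xs : List ℕ) → IsAscentSeq xs →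
      (Avoids (1 ∷ 0 ∷ 1 ∷ []) xs ⇔ Avoids (0 ∷ 1 ∷ 0 ∷ 1 ∷ []) xs)) ×
    ((m : ℕ) →
      HasCount (λ xs → (length xs ≡ suc m) × IsAscentSeq xs × Avoids (1 ∷ 0 ∷ 1 ∷ []) xs)
               (catalan (suc m))) ×
    ((m k : ℕ) → k ≤ m →
      HasCount (λ xs → (length xs ≡ suc m) × IsAscentSeq xs × Avoids (1 ∷ 0 ∷ 1 ∷ []) xs
                       × (asc xs ≡ k))
               (narayana m (suc k)))
theorem2p5 =
  avoidance-equivalence ,
  (λ m → counted (avoiders-enumerate m) (avoiders-length m)) ,
  (λ m k _ → counted (avoiders-with-ascents m k) (avoiders-ascents m k))
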